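{- Let $n$ be an even positive integer and $k$ a positive integer, let $\mathcal G\subset[n]^k$, and let $(M_1,\ldots,M_n)$ be an ordered perfect matching of $[n]^k$ chosen uniformly at random. For $1\le i\le n$ let $\eta_i$ be the indicator of the event $M_i\in\mathcal G$, and put $\eta=\eta_1+\cdots+\eta_n$ and $\tilde\eta=\eta_1+\cdots+\eta_{n/2}$. Then for every real $a>0$ and $\delta\in\{ -1,1\}$, $$\mathsf P[\delta\cdot(\eta-\mathsf E\eta)\ge 2a]\le 2\,\mathsf P[\delta\cdot(\tilde\eta-\mathsf E\tilde\eta)\ge a].$$
   Context: $[n]=\{1,\ldots,n\}$ and $[n]^k$ is the set of $k$-tuples with entries in $[n]$. Two tuples are disjoint if they differ in every coordinate. An ordered perfect matching of $[n]^k$ is a sequence $(M_1,\ldots,M_n)$ of $n$ pairwise disjoint tuples of $[n]^k$.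
   Formalization: The parameter a ranges over the positive rationals instead of the positive reals. -}

module Defs where

open import Data.Bool using (Bool; true; false; if_then_else_)
open import Data.Nat as ℕ using (ℕ; zero; suc)
open import Data.Integer using (+_)
open import Data.Fin using (Fin; toℕ)
open import Data.Fin.Properties using (all?; _≟_)
open import Data.Vec using (Vec; []; _∷_; lookup)
open import Data.List using (List; []; _∷_; map; concatMap; filter; length; foldr; allFin)
open import Data.Rational using (ℚ; 0ℚ; 1ℚ; _+_; _*_; _-_; _/_; _≤_)
open import Data.Rational.Properties using (_≤?_)
open import Relation.Nullary using (¬_; Dec)
open import Relation.Nullary.Decidable using (_→-dec_; ¬?)
open import Relation.Binary.PropositionalEquality using (_≡_)

-- k-tuples with entries in [n] (entries are Fin n ≅ {1,…,n}, shifted by one)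
Tuple : ℕ → ℕ → Set
Tuple n k = Vec (Fin n) k

Disjoint : ∀ {n k} → Tuple n k → Tuple n k → Set
Disjoint {k = k} t s = ∀ (j : Fin k) → ¬ (lookup t j ≡ lookup s j)

disjoint? : ∀ {n k} (t s : Tuple n k) → Dec (Disjoint t s)
disjoint? t s = all? (λ j → ¬? (lookup t j ≟ lookup s j))

IsOrderedPerfectMatching : ∀ n k → Vec (Tuple n k) n → Set
IsOrderedPerfectMatching n k M =
  ∀ (i j : Fin n) → ¬ (i ≡ j) → Disjoint (lookup M i) (lookup M j)

isOPM? : ∀ n k (M : Vec (Tuple n k) n) → Dec (IsOrderedPerfectMatching n k M)
isOPM? n k M = all? (λ i → all? (λ j → ¬? (i ≟ j) →-dec disjoint? (lookup M i) (lookup M j)))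

allVecs : ∀ {A : Set} (m : ℕ) → List A → List (Vec A m)
allVecs zero    xs = [] ∷ []
allVecs (suc m) xs = concatMap (λ x → map (x ∷_) (allVecs m xs)) xs

allTuples : ∀ n k → List (Tuple n k)
allTuples n k = allVecs k (allFin n)

-- the finite sample space: all ordered perfect matchings of [n]^k (each listed once)
OPMs : ∀ n k → List (Vec (Tuple n k) n)
OPMs n k = filter (isOPM? n k) (allVecs n (allTuples n k))

-- a / d as a rational (d = 0 only for an empty sample space; convention 0)
ratio : ℕ → ℕ → ℚ
ratio a zero    = 0ℚ
ratio a (suc d) = (+ a) / (suc d)

Pr : ∀ {A : Set} {P : A → Set} → List A → ((x : A) → Dec (P x)) → ℚ
Pr L P? = ratio (length (filter P? L)) (length L)

E : ∀ {A : Set} → List A → (A → ℚ) → ℚ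
E L f = foldr _+_ 0ℚ (map f L) * ratio 1 (length L)

ind : Bool → ℚ
ind b = if b then 1ℚ else 0ℚ

sumℚ : List ℚ → ℚ
sumℚ = foldr _+_ 0ℚ

η : ∀ {n k} → (Tuple n k → Bool) → Vec (Tuple n k) n → ℚ
η {n} G M = sumℚ (map (λ i → ind (G (lookup M i))) (allFin n))

η̃ : ∀ {n k} → ℕ → (Tuple n k → Bool) → Vec (Tuple n k) n → ℚ
η̃ {n} h G M = sumℚ (map (λ i → ind (G (lookup M i)))
                      (filter (λ i → toℕ i ℕ.<? h) (allFin n)))

-- Swapping the two halves of the index set, i ↦ i ± n/2, permutes the ordered perfect
-- matchings, so η̃ and η − η̃ (which is η̃ after the swap) have the same distribution and
-- Eη = 2Eη̃. If δ(η − Eη) ≥ 2a, then one of the two halves deviates by at least a, and the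
-- union bound together with this equidistribution gives the factor 2.
module Submission where

open import Defs
open import Data.Bool using (Bool)
open import Data.Nat using (ℕ; _≤_)
open import Data.Nat as ℕ using ()
open import Data.Integer using (+_)
open import Data.Rational using (ℚ; 0ℚ; 1ℚ; _+_; _*_; _-_; _/_; _<_; -_)
open import Data.Rational.Properties using (_≤?_)
open import Data.Rational as ℚ using ()
open import Data.Sum using (_⊎_)
open import Relation.Binary.PropositionalEquality using (_≡_)

open import Algebra.Bundles using (CommutativeMonoid)
open import Data.Empty using (⊥-elim)
open import Data.Fin using (Fin; toℕ; fromℕ<)
open import Data.Fin.Properties using (toℕ-injective; toℕ-fromℕ<; toℕ<n)
open import Data.Integer as ℤ using ()
open import Data.Integer.Properties as ℤP using ()
open import Data.Integer.Solver renaming (module +-*-Solver to ℤ-Solver)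
open import Data.List using (List; []; _∷_; _++_; map; concatMap; cartesianProductWith; filter; length; allFin)
open import Data.List.Properties using (map-cong; map-∘; length-map; filter-≐)
open import Data.List.Membership.Propositional using (_∈_)
open import Data.List.Membership.Propositional.Properties
  using (∈-map⁺; ∈-map⁻; ∈-filter⁺; ∈-filter⁻; ∈-allFin; ∈-cartesianProductWith⁺)
open import Data.List.Membership.Propositional.Properties.WithK using (unique∧set⇒bag)
open import Data.List.Relation.Binary.BagAndSetEquality using (∼bag⇒↭)
open import Data.List.Relation.Binary.Permutation.Propositional using (_↭_; ↭⇒↭ₛ; module PermutationReasoning)
open import Data.List.Relation.Binary.Permutation.Propositional.Properties using (map⁺; filter-↭; ↭-length)
open import Data.List.Relation.Binary.Permutation.Setoid.Properties using (foldr-commMonoid)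
open import Data.List.Relation.Unary.All using ([])
open import Data.List.Relation.Unary.AllPairs using ([]; _∷_)
open import Data.List.Relation.Unary.Any using (here)
open import Data.List.Relation.Unary.Unique.Propositional using (Unique)
open import Data.List.Relation.Unary.Unique.Propositional.Properties as Unique using ()
open import Data.Nat using (zero; suc; z≤n; s≤s; _<?_)
open import Data.Nat.Properties as ℕP using ()
open import Data.Product using (_,_; proj₂)
open import Data.Rational using (toℚᵘ)
open import Data.Rational.Properties as ℚP using ()
open import Data.Rational.Solver renaming (module +-*-Solver to ℚ-Solver)
open import Data.Rational.Unnormalised as ℚᵘ using (mkℚᵘ; *≡*; *≤*)
open import Data.Rational.Unnormalised.Properties as ℚᵘP using ()
open import Data.Sum using (inj₁; inj₂; [_,_])
open import Data.Vec using (Vec; []; _∷_; lookup; tabulate)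
open import Data.Vec.Properties using (∷-injective; lookup∘tabulate; tabulate∘lookup; tabulate-cong)
open import Function using (_∘_; mk⇔)
open import Function.Definitions using (Injective)
open import Level using (Level; 0ℓ)
open import Relation.Binary.PropositionalEquality
  using (refl; sym; trans; cong; cong₂; subst; subst₂; setoid; module ≡-Reasoning)
open import Relation.Nullary using (Dec; yes; no; ¬_; contradiction)
open import Relation.Nullary.Decidable using (decidable-stable)
open import Relation.Unary using (Pred; Decidable)
open import Relation.Unary.Properties using (∁?)

open import Algebra.Properties.CommutativeSemigroup (CommutativeMonoid.commutativeSemigroup ℚP.+-0-commutativeMonoid)
  using () renaming (interchange to +-interchange; x∙yz≈y∙xz to x+[y+z]≡y+[x+z])

private variable ℓ₁ ℓ₂ ℓ₃ : Level

module _ {A : Set} where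

  length-filter-∷ : ∀ {P : Pred A ℓ₁} (P? : Decidable P) x xs →
                    length (filter P? xs) ≤ length (filter P? (x ∷ xs))
  length-filter-∷ P? x xs with P? x
  ... | yes _ = ℕP.n≤1+n _
  ... | no  _ = ℕP.≤-refl

  length-filter-∪ : ∀ {P : Pred A ℓ₁} {Q : Pred A ℓ₂} {R : Pred A ℓ₃}
                    (P? : Decidable P) (Q? : Decidable Q) (R? : Decidable R) →
                    (∀ {x} → P x → Q x ⊎ R x) → ∀ xs →
                    length (filter P? xs) ≤ length (filter Q? xs) ℕ.+ length (filter R? xs)
  length-filter-∪ P? Q? R? P⊆Q∪R []       = z≤n
  length-filter-∪ P? Q? R? P⊆Q∪R (x ∷ xs) with ih ← length-filter-∪ P? Q? R? P⊆Q∪R xs | P? x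
  ... | no _ = ℕP.≤-trans ih (ℕP.+-mono-≤ (length-filter-∷ Q? x xs) (length-filter-∷ R? x xs))
  ... | yes px with Q? x
  ...   | yes _ = s≤s (ℕP.≤-trans ih (ℕP.+-monoʳ-≤ _ (length-filter-∷ R? x xs)))
  ...   | no ¬q with R? x
  ...     | yes _ =
    subst (suc (length (filter P? xs)) ≤_) (sym (ℕP.+-suc (length (filter Q? xs)) _)) (s≤s ih)
  ...     | no ¬r = contradiction (P⊆Q∪R px) [ ¬q , ¬r ]

  filter-map : ∀ {B : Set} {P : Pred B ℓ₁} (P? : Decidable P) (f : A → B) xs →
               filter P? (map f xs) ≡ map f (filter (P? ∘ f) xs)
  filter-map P? f []       = refl
  filter-map P? f (x ∷ xs) with P? (f x)
  ... | yes _ = cong (f x ∷_) (filter-map P? f xs)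
  ... | no  _ = filter-map P? f xs

sumℚ-↭ : ∀ {xs ys} → xs ↭ ys → sumℚ xs ≡ sumℚ ys
sumℚ-↭ xs↭ys = foldr-commMonoid (setoid ℚ) ℚP.+-0-isCommutativeMonoid (↭⇒↭ₛ xs↭ys)

module _ {A : Set} where

  sumℚ-map-+ : ∀ (f g : A → ℚ) xs →
               sumℚ (map (λ x → f x + g x) xs) ≡ sumℚ (map f xs) + sumℚ (map g xs)
  sumℚ-map-+ f g []       = sym (ℚP.+-identityʳ 0ℚ)
  sumℚ-map-+ f g (x ∷ xs) =
    trans (cong (_+_ (f x + g x)) (sumℚ-map-+ f g xs)) (+-interchange (f x) (g x) _ _)

  sumℚ-map-filter : ∀ {P : Pred A ℓ₁} (P? : Decidable P) (f : A → ℚ) xs →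
                    sumℚ (map f xs) ≡ sumℚ (map f (filter P? xs)) + sumℚ (map f (filter (∁? P?) xs))
  sumℚ-map-filter P? f []       = sym (ℚP.+-identityʳ 0ℚ)
  sumℚ-map-filter P? f (x ∷ xs) with P? x
  ... | yes _ = trans (cong (_+_ (f x)) (sumℚ-map-filter P? f xs))
                      (sym (ℚP.+-assoc (f x) accepted rejected))
    where accepted = sumℚ (map f (filter P? xs)); rejected = sumℚ (map f (filter (∁? P?) xs))
  ... | no  _ = trans (cong (_+_ (f x)) (sumℚ-map-filter P? f xs))
                      (x+[y+z]≡y+[x+z] (f x) accepted rejected)
    where accepted = sumℚ (map f (filter P? xs)); rejected = sumℚ (map f (filter (∁? P?) xs))

ratio-mono-≤ : ∀ {a b} N → a ≤ b → ratio a N ℚ.≤ ratio b N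
ratio-mono-≤         zero    a≤b = ℚP.≤-refl
ratio-mono-≤ {a} {b} (suc d) a≤b = ℚP.toℚᵘ-cancel-≤
  (ℚᵘP.≤-respˡ-≃ (ℚᵘP.≃-sym (ℚP.toℚᵘ-fromℚᵘ (mkℚᵘ (+ a) d)))
  (ℚᵘP.≤-respʳ-≃ (ℚᵘP.≃-sym (ℚP.toℚᵘ-fromℚᵘ (mkℚᵘ (+ b) d)))
  (*≤* (ℤP.*-monoʳ-≤-nonNeg (+ suc d) (ℤ.+≤+ a≤b)))))

ratio-+ : ∀ a b N → ratio (a ℕ.+ b) N ≡ ratio a N + ratio b N
ratio-+ a b zero    = sym (ℚP.+-identityʳ 0ℚ)
ratio-+ a b (suc d) = ℚP.toℚᵘ-injective (begin
  toℚᵘ (ratio (a ℕ.+ b) (suc d))  ≈⟨ ℚP.toℚᵘ-fromℚᵘ (mkℚᵘ (+ (a ℕ.+ b)) d) ⟩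
  mkℚᵘ (+ (a ℕ.+ b)) d           ≈⟨ *≡* common-denominator ⟩
  mkℚᵘ (+ a) d ℚᵘ.+ mkℚᵘ (+ b) d  ≈⟨ ℚᵘP.+-cong (ℚP.toℚᵘ-fromℚᵘ (mkℚᵘ (+ a) d))
                                                 (ℚP.toℚᵘ-fromℚᵘ (mkℚᵘ (+ b) d)) ⟨
  toℚᵘ p ℚᵘ.+ toℚᵘ q              ≈⟨ ℚP.toℚᵘ-homo-+ p q ⟨
  toℚᵘ (p + q)                    ∎)
  where
  open ℚᵘP.≃-Reasoning
  p = ratio a (suc d)
  q = ratio b (suc d)
  common-denominator : + (a ℕ.+ b) ℤ.* + (suc d ℕ.* suc d)
                       ≡ (+ a ℤ.* + suc d ℤ.+ + b ℤ.* + suc d) ℤ.* + suc d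
  common-denominator = trans (cong₂ ℤ._*_ (ℤP.pos-+ a b) (ℤP.pos-* (suc d) (suc d)))
    (solve 3 (λ x y s → (x :+ y) :* (s :* s) := (x :* s :+ y :* s) :* s) refl (+ a) (+ b) (+ suc d))
    where open ℤ-Solver

module _ {A : Set} (L : List A) where

  E-cong : ∀ {f g : A → ℚ} → (∀ x → f x ≡ g x) → E L f ≡ E L g
  E-cong f≗g = cong (λ s → sumℚ s * ratio 1 (length L)) (map-cong f≗g L)

  E-+ : ∀ (f g : A → ℚ) → E L (λ x → f x + g x) ≡ E L f + E L g
  E-+ f g = trans (cong (_* ratio 1 (length L)) (sumℚ-map-+ f g L))
                  (ℚP.*-distribʳ-+ (ratio 1 (length L)) (sumℚ (map f L)) (sumℚ (map g L)))

  E-∘-↭ : ∀ {σ : A → A} → map σ L ↭ L → ∀ (f : A → ℚ) → E L (f ∘ σ) ≡ E L f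
  E-∘-↭ σL↭L f = cong (_* ratio 1 (length L)) (trans (cong sumℚ (map-∘ L)) (sumℚ-↭ (map⁺ f σL↭L)))

  Pr-∪ : ∀ {P Q R : Pred A 0ℓ} (P? : Decidable P) (Q? : Decidable Q) (R? : Decidable R) →
         (∀ {x} → P x → Q x ⊎ R x) → Pr L P? ℚ.≤ Pr L Q? + Pr L R?
  Pr-∪ P? Q? R? P⊆Q∪R = ℚP.≤-trans
    (ratio-mono-≤ (length L) (length-filter-∪ P? Q? R? P⊆Q∪R L))
    (ℚP.≤-reflexive (ratio-+ (length (filter Q? L)) (length (filter R? L)) (length L)))

  Pr-∘-↭ : ∀ {σ : A → A} → map σ L ↭ L → ∀ {P : Pred A 0ℓ} (P? : Decidable P) →
           Pr L (P? ∘ σ) ≡ Pr L P?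
  Pr-∘-↭ {σ} σL↭L P? = cong (λ c → ratio c (length L)) (begin
    length (filter (P? ∘ σ) L)          ≡⟨ length-map σ (filter (P? ∘ σ) L) ⟨
    length (map σ (filter (P? ∘ σ) L))  ≡⟨ cong length (filter-map P? σ L) ⟨
    length (filter P? (map σ L))        ≡⟨ ↭-length (filter-↭ P? σL↭L) ⟩
    length (filter P? L)                ∎)
    where open ≡-Reasoning

involutive⇒injective : ∀ {A : Set} {σ : A → A} → (∀ x → σ (σ x) ≡ x) → Injective _≡_ _≡_ σ
involutive⇒injective {σ = σ} σσ≡id {x} {y} σx≡σy =
  trans (sym (σσ≡id x)) (trans (cong σ σx≡σy) (σσ≡id y))

map-involution-↭ : ∀ {A : Set} {σ : A → A} → (∀ x → σ (σ x) ≡ x) → ∀ {xs} → Unique xs →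
                   (∀ {x} → x ∈ xs → σ x ∈ xs) → map σ xs ↭ xs
map-involution-↭ {σ = σ} σσ≡id {xs} xs! σ-closed =
  ∼bag⇒↭ (unique∧set⇒bag (Unique.map⁺ (involutive⇒injective σσ≡id) xs!) xs! (mk⇔ to from))
  where
  to : ∀ {x} → x ∈ map σ xs → x ∈ xs
  to x∈σxs with _ , y∈xs , refl ← ∈-map⁻ σ x∈σxs = σ-closed y∈xs
  from : ∀ {x} → x ∈ xs → x ∈ map σ xs
  from {x} x∈xs = subst (_∈ map σ xs) (σσ≡id x) (∈-map⁺ σ (σ-closed x∈xs))

concatMap-map : ∀ {A B C : Set} (f : A → B → C) xs ys →
                concatMap (λ x → map (f x) ys) xs ≡ cartesianProductWith f xs ys
concatMap-map f []       ys = refl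
concatMap-map f (x ∷ xs) ys = cong (map (f x) ys ++_) (concatMap-map f xs ys)

module _ {A : Set} {xs : List A} where

  allVecs-unique : Unique xs → ∀ m → Unique (allVecs m xs)
  allVecs-unique xs! zero    = [] ∷ []
  allVecs-unique xs! (suc m) = subst Unique (sym (concatMap-map _∷_ xs (allVecs m xs)))
    (Unique.cartesianProductWith⁺ _∷_ ∷-injective xs! (allVecs-unique xs! m))

  ∈-allVecs : (∀ x → x ∈ xs) → ∀ {m} (v : Vec A m) → v ∈ allVecs m xs
  ∈-allVecs ∈xs []      = here refl
  ∈-allVecs ∈xs (x ∷ v) = subst ((x ∷ v) ∈_) (sym (concatMap-map _∷_ xs (allVecs _ xs)))
    (∈-cartesianProductWith⁺ _∷_ (∈xs x) (∈-allVecs ∈xs v))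

reindex : ∀ {A : Set} {n} → (Fin n → Fin n) → Vec A n → Vec A n
reindex π M = tabulate (lookup M ∘ π)

reindex-OPM : ∀ {n k} {π : Fin n → Fin n} → Injective _≡_ _≡_ π → ∀ {M : Vec (Tuple n k) n} →
              IsOrderedPerfectMatching n k M → IsOrderedPerfectMatching n k (reindex π M)
reindex-OPM {π = π} π-injective {M} M-opm i j i≢j =
  subst₂ Disjoint (sym (lookup∘tabulate (lookup M ∘ π) i)) (sym (lookup∘tabulate (lookup M ∘ π) j))
    (M-opm (π i) (π j) (i≢j ∘ π-injective))

module _ {n : ℕ} {π : Fin n → Fin n} (ππ≡id : ∀ i → π (π i) ≡ i) where

  reindex-involutive : ∀ {A : Set} (M : Vec A n) → reindex π (reindex π M) ≡ M
  reindex-involutive M = trans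
    (tabulate-cong (λ i → trans (lookup∘tabulate (lookup M ∘ π) (π i)) (cong (lookup M) (ππ≡id i))))
    (tabulate∘lookup M)

  map-reindex-OPMs-↭ : ∀ k → map (reindex π) (OPMs n k) ↭ OPMs n k
  map-reindex-OPMs-↭ k = map-involution-↭ reindex-involutive
    (Unique.filter⁺ (isOPM? n k) (allVecs-unique (allVecs-unique (Unique.allFin⁺ n) k) n))
    reindex-closed
    where
    reindex-closed : ∀ {M} → M ∈ OPMs n k → reindex π M ∈ OPMs n k
    reindex-closed {M} M∈OPMs = ∈-filter⁺ (isOPM? n k)
      (∈-allVecs (∈-allVecs ∈-allFin) (reindex π M))
      (reindex-OPM (involutive⇒injective ππ≡id) {M}
        (proj₂ (∈-filter⁻ (isOPM? n k) {xs = allVecs n (allTuples n k)} M∈OPMs)))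

module _ (m : ℕ) where

  lower? : Decidable {A = Fin (2 ℕ.* m)} (λ i → toℕ i ℕ.< m)
  lower? i = toℕ i <? m

  -- 2 ℕ.* m unfolds to m ℕ.+ (m ℕ.+ 0), whence the stray + 0 in the bounds below.
  swapHalves : Fin (2 ℕ.* m) → Fin (2 ℕ.* m)
  swapHalves i with lower? i
  ... | yes i<m = fromℕ< (ℕP.+-monoʳ-< m (ℕP.m≤n⇒m≤n+o 0 i<m))
  ... | no  _   = fromℕ< (ℕP.≤-<-trans (ℕP.m∸n≤m (toℕ i) m) (toℕ<n i))

  toℕ-swapHalves-< : ∀ {i} → toℕ i ℕ.< m → toℕ (swapHalves i) ≡ m ℕ.+ toℕ i
  toℕ-swapHalves-< {i} i<m with lower? i
  ... | yes _   = toℕ-fromℕ< _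
  ... | no  i≮m = contradiction i<m i≮m

  toℕ-swapHalves-≮ : ∀ {i} → ¬ toℕ i ℕ.< m → toℕ (swapHalves i) ≡ toℕ i ℕ.∸ m
  toℕ-swapHalves-≮ {i} i≮m with lower? i
  ... | yes i<m = contradiction i<m i≮m
  ... | no  _   = toℕ-fromℕ< _

  swapHalves-<-≮ : ∀ {i} → toℕ i ℕ.< m → ¬ toℕ (swapHalves i) ℕ.< m
  swapHalves-<-≮ {i} i<m σi<m = ℕP.<⇒≱ σi<m
    (subst (m ≤_) (sym (toℕ-swapHalves-< i<m)) (ℕP.m≤m+n m (toℕ i)))

  swapHalves-≮-< : ∀ {i} → ¬ toℕ i ℕ.< m → toℕ (swapHalves i) ℕ.< m
  swapHalves-≮-< {i} i≮m = subst (ℕ._< m) (sym (toℕ-swapHalves-≮ i≮m))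
    (subst (toℕ i ℕ.∸ m ℕ.<_) (trans (ℕP.m+n∸m≡n m (m ℕ.+ 0)) (ℕP.+-identityʳ m))
      (ℕP.∸-monoˡ-< (toℕ<n i) (ℕP.≮⇒≥ i≮m)))

  swapHalves-involutive : ∀ i → swapHalves (swapHalves i) ≡ i
  swapHalves-involutive i = toℕ-injective (by-half (lower? i))
    where
    open ≡-Reasoning
    by-half : Dec (toℕ i ℕ.< m) → toℕ (swapHalves (swapHalves i)) ≡ toℕ i
    by-half (yes i<m) = begin
      toℕ (swapHalves (swapHalves i))  ≡⟨ toℕ-swapHalves-≮ (swapHalves-<-≮ i<m) ⟩
      toℕ (swapHalves i) ℕ.∸ m         ≡⟨ cong (ℕ._∸ m) (toℕ-swapHalves-< i<m) ⟩
      m ℕ.+ toℕ i ℕ.∸ m                ≡⟨ ℕP.m+n∸m≡n m (toℕ i) ⟩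
      toℕ i                            ∎
    by-half (no i≮m) = begin
      toℕ (swapHalves (swapHalves i))  ≡⟨ toℕ-swapHalves-< (swapHalves-≮-< i≮m) ⟩
      m ℕ.+ toℕ (swapHalves i)         ≡⟨ cong (m ℕ.+_) (toℕ-swapHalves-≮ i≮m) ⟩
      m ℕ.+ (toℕ i ℕ.∸ m)              ≡⟨ ℕP.m+[n∸m]≡n (ℕP.≮⇒≥ i≮m) ⟩
      toℕ i                            ∎

  map-swapHalves-lower-↭ : map swapHalves (filter lower? (allFin (2 ℕ.* m)))
                           ↭ filter (∁? lower?) (allFin (2 ℕ.* m))
  map-swapHalves-lower-↭ = begin
    map swapHalves (filter lower? (allFin _))
      ≡⟨ cong (map swapHalves) lower≐upper∘swap ⟩
    map swapHalves (filter (∁? lower? ∘ swapHalves) (allFin _))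
      ≡⟨ filter-map (∁? lower?) swapHalves (allFin _) ⟨
    filter (∁? lower?) (map swapHalves (allFin _))
      ↭⟨ filter-↭ (∁? lower?) swapHalves-permutes ⟩
    filter (∁? lower?) (allFin _)
      ∎
    where
    open PermutationReasoning
    lower≐upper∘swap : filter lower? (allFin _) ≡ filter (∁? lower? ∘ swapHalves) (allFin _)
    lower≐upper∘swap = filter-≐ lower? (∁? lower? ∘ swapHalves)
      (swapHalves-<-≮ , λ {i} σi≮m → decidable-stable (lower? i) (σi≮m ∘ swapHalves-≮-<)) (allFin _)
    swapHalves-permutes : map swapHalves (allFin _) ↭ allFin _
    swapHalves-permutes =
      map-involution-↭ swapHalves-involutive (Unique.allFin⁺ _) (λ {i} _ → ∈-allFin (swapHalves i))

2*x≡x+x : ∀ x → (+ 2 / 1) * x ≡ x + x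
2*x≡x+x x = trans (ℚP.*-distribʳ-+ x 1ℚ 1ℚ) (cong₂ _+_ (ℚP.*-identityˡ x) (ℚP.*-identityˡ x))

a+b≤x+y⇒a≤x⊎b≤y : ∀ {a b x y} → a + b ℚ.≤ x + y → a ℚ.≤ x ⊎ b ℚ.≤ y
a+b≤x+y⇒a≤x⊎b≤y {a} {b} {x} {y} a+b≤x+y with a ≤? x | b ≤? y
... | yes a≤x | _       = inj₁ a≤x
... | no  _   | yes b≤y = inj₂ b≤y
... | no  a≰x | no  b≰y =
  ⊥-elim (ℚP.<-irrefl refl (ℚP.<-≤-trans (ℚP.+-mono-< (ℚP.≰⇒> a≰x) (ℚP.≰⇒> b≰y)) a+b≤x+y))

deviation-+ : ∀ δ u v e → δ * ((u + v) - (e + e)) ≡ δ * (u - e) + δ * (v - e)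
deviation-+ = solve 4 (λ δ u v e → δ :* ((u :+ v) :- (e :+ e)) := δ :* (u :- e) :+ δ :* (v :- e)) refl
  where open ℚ-Solver

module _ (m k : ℕ) (G : Tuple (2 ℕ.* m) k → Bool) where

  private
    L = OPMs (2 ℕ.* m) k
    σ = reindex {Tuple (2 ℕ.* m) k} (swapHalves m)

  η-split : ∀ M → η G M ≡ η̃ m G M + η̃ m G (σ M)
  η-split M =
    trans (sumℚ-map-filter (lower? m) g (allFin _)) (cong (_+_ (η̃ m G M)) (sym upper-sum))
    where
    open ≡-Reasoning
    lower = filter (lower? m) (allFin (2 ℕ.* m))
    upper = filter (∁? (lower? m)) (allFin (2 ℕ.* m))
    g : Fin (2 ℕ.* m) → ℚ
    g i = ind (G (lookup M i))
    upper-sum : η̃ m G (σ M) ≡ sumℚ (map g upper)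
    upper-sum = begin
      η̃ m G (σ M)
        ≡⟨ cong sumℚ (map-cong (cong (ind ∘ G) ∘ lookup∘tabulate (lookup M ∘ swapHalves m)) lower) ⟩
      sumℚ (map (g ∘ swapHalves m) lower)
        ≡⟨ cong sumℚ (map-∘ lower) ⟩
      sumℚ (map g (map (swapHalves m) lower))
        ≡⟨ sumℚ-↭ (map⁺ g (map-swapHalves-lower-↭ m)) ⟩
      sumℚ (map g upper)
        ∎

  σ-permutes-OPMs : map σ L ↭ L
  σ-permutes-OPMs = map-reindex-OPMs-↭ (swapHalves-involutive m) k

  E-η : E L (η G) ≡ E L (η̃ m G) + E L (η̃ m G)
  E-η = begin
    E L (η G)                           ≡⟨ E-cong L η-split ⟩
    E L (λ M → η̃ m G M + η̃ m G (σ M))  ≡⟨ E-+ L (η̃ m G) (η̃ m G ∘ σ) ⟩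
    E L (η̃ m G) + E L (η̃ m G ∘ σ)      ≡⟨ cong (_+_ (E L (η̃ m G))) (E-∘-↭ L σ-permutes-OPMs (η̃ m G)) ⟩
    E L (η̃ m G) + E L (η̃ m G)          ∎
    where open ≡-Reasoning

  large-deviation-split : ∀ a δ M →
    (+ 2 / 1) * a ℚ.≤ δ * (η G M - E L (η G)) →
    a ℚ.≤ δ * (η̃ m G M - E L (η̃ m G)) ⊎ a ℚ.≤ δ * (η̃ m G (σ M) - E L (η̃ m G))
  large-deviation-split a δ M = a+b≤x+y⇒a≤x⊎b≤y ∘ subst₂ ℚ._≤_ (2*x≡x+x a) deviation
    where
    e = E L (η̃ m G)
    deviation : δ * (η G M - E L (η G)) ≡ δ * (η̃ m G M - e) + δ * (η̃ m G (σ M) - e)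
    deviation = trans (cong₂ (λ u v → δ * (u - v)) (η-split M) E-η)
                      (deviation-+ δ (η̃ m G M) (η̃ m G (σ M)) e)

proposition3 : (m k : ℕ) → 1 ≤ m → 1 ≤ k →
    (G : Tuple (2 ℕ.* m) k → Bool) →
    (a δ : ℚ) → 0ℚ < a → (δ ≡ 1ℚ ⊎ δ ≡ - 1ℚ) →
    Pr (OPMs (2 ℕ.* m) k)
       (λ M → ((+ 2 / 1) * a) ≤? (δ * (η G M - E (OPMs (2 ℕ.* m) k) (η G))))
    ℚ.≤ (+ 2 / 1) *
    Pr (OPMs (2 ℕ.* m) k)
       (λ M → a ≤? (δ * (η̃ m G M - E (OPMs (2 ℕ.* m) k) (η̃ m G))))
proposition3 m k _ _ G a δ _ _ = begin
  Pr L P?                 ≤⟨ Pr-∪ L P? Q? (Q? ∘ σ) (λ {M} → large-deviation-split m k G a δ M) ⟩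
  Pr L Q? + Pr L (Q? ∘ σ) ≡⟨ cong (_+_ (Pr L Q?)) (Pr-∘-↭ L (σ-permutes-OPMs m k G) Q?) ⟩
  Pr L Q? + Pr L Q?       ≡⟨ 2*x≡x+x (Pr L Q?) ⟨
  (+ 2 / 1) * Pr L Q?     ∎
  where
  open ℚP.≤-Reasoning
  L = OPMs (2 ℕ.* m) k
  σ = reindex (swapHalves m)
  P? = λ M → ((+ 2 / 1) * a) ≤? (δ * (η G M - E L (η G)))
  Q? = λ M → a ≤? (δ * (η̃ m G M - E L (η̃ m G)))
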